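{- Let $A$ be a $\{ -,\triangleright\}$-algebra satisfying (Ax.1)–(Ax.5), and let $\pi:A\to A/{\sim}$ be the canonical projection. For every filter $F$ of $A$, the set $\pi[F]^{\uparrow}$ (upward closure in $A/{\sim}$) is a filter of $A/{\sim}$, and every filter of $A/{\sim}$ is of this form. Moreover, for all filters $F,G$ of $A$, $$F\preceq G\iff \pi[G]^{\uparrow}\subseteq\pi[F]^{\uparrow}.$$ In particular, $F\approx G$ iff $\pi[F]^{\uparrow}=\pi[G]^{\uparrow}$, so the quotient map from filters of $A$ onto filters modulo $\approx$ and the surjection $F\mapsto\pi[F]^{\uparrow}$ onto the filters of $A/{\sim}$ are isomorphic.
   Context: A $\{ -,\triangleright\}$-algebra is a set $A$ with binary operations $-,\triangleright$. Write $a\cdot b:=a-(a-b)$. Axioms: (Ax.1) $a-(b-a)=a$; (Ax.2) $a\cdot b=b\cdot a$; (Ax.3) $(a-b)-c=(a-c)-b$; (Ax.4) $(a\triangleright c)\cdot(b\triangleright c)=(a\triangleright b)\triangleright c$; (Ax.5) $(a\cdot b)\triangleright a=a\cdot b$. Then $(A,\cdot)$ is a meet-semilattice ordered by $a\le b\iff a\cdot b=a$. Define the preorder $a\preceq b\iff a\le b\triangleright a$ on $A$, with induced equivalence $\sim$; $A/{\sim}$ is ordered by $[a]\le[b]\iff a\preceq b$ and is a meet-semilattice with $[a]\wedge[b]=[a\triangleright b]$. A filter of a meet-semilattice is a nonempty upward closed subset closed under binary meets. For filters $F,G$ of $A$, let $G\triangleright F=\{g\triangleright f\mid g\in G,f\in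 F\}$, $F\preceq G\iff G\triangleright F\subseteq F$, and $F\approx G\iff F\preceq G\text{ and }G\preceq F$. -}

module Defs where

open import Level using (0ℓ)
open import Data.Product using (Σ; ∃; _×_; _,_)
open import Relation.Binary.PropositionalEquality using (_≡_)
open import Relation.Unary using (Pred; _∈_; _⊆_)
open import Function.Bundles using (_⇔_)

record MinusTriAlgebra : Set₁ where
  infixl 6 _-_
  infixl 7 _·_
  infixl 5 _▷_
  field
    Carrier : Set
    _-_ : Carrier → Carrier → Carrier
    _▷_ : Carrier → Carrier → Carrier

  _·_ : Carrier → Carrier → Carrier
  a · b = a - (a - b)

  field
    ax1 : ∀ a b → a - (b - a) ≡ a
    ax2 : ∀ a b → a · b ≡ b · a
    ax3 : ∀ a b c → (a - b) - c ≡ (a - c) - b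
    ax4 : ∀ a b c → (a ▷ c) · (b ▷ c) ≡ (a ▷ b) ▷ c
    ax5 : ∀ a b → (a · b) ▷ a ≡ a · b

module AlgebraNotions (A : MinusTriAlgebra) where
  open MinusTriAlgebra A

  _≤_ : Carrier → Carrier → Set
  a ≤ b = a · b ≡ a

  _⪯_ : Carrier → Carrier → Set
  a ⪯ b = a ≤ (b ▷ a)

  _∼_ : Carrier → Carrier → Set
  a ∼ b = (a ⪯ b) × (b ⪯ a)

  record Filter : Set₁ where
    field
      set      : Pred Carrier 0ℓ
      nonempty : ∃ λ a → a ∈ set
      upward   : ∀ {a b} → a ∈ set → a ≤ b → b ∈ set
      meet     : ∀ {a b} → a ∈ set → b ∈ set → (a · b) ∈ set
  open Filter public

  -- The quotient A/∼ is represented as the setoid (Carrier, ∼), ordered by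
  -- [a] ≤ [b] iff a ⪯ b, with meet [a] ∧ [b] = [a ▷ b].  A subset of A/∼ is
  -- represented by a ∼-saturated predicate on Carrier (its preimage under π).
  record QFilter : Set₁ where
    field
      qset      : Pred Carrier 0ℓ
      qrespects : ∀ {a b} → a ∼ b → a ∈ qset → b ∈ qset
      qnonempty : ∃ λ a → a ∈ qset
      qupward   : ∀ {a b} → a ∈ qset → a ⪯ b → b ∈ qset
      qmeet     : ∀ {a b} → a ∈ qset → b ∈ qset → (a ▷ b) ∈ qset
  open QFilter public

  πUp : Pred Carrier 0ℓ → Pred Carrier 0ℓ
  πUp F a = ∃ λ f → (f ∈ F) × (f ⪯ a)

  IsQFilter : Pred Carrier 0ℓ → Set
  IsQFilter P =
      (∀ {a b} → a ∼ b → a ∈ P → b ∈ P)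
    × (∃ λ a → a ∈ P)
    × (∀ {a b} → a ∈ P → a ⪯ b → b ∈ P)
    × (∀ {a b} → a ∈ P → b ∈ P → (a ▷ b) ∈ P)

  _≐_ : Pred Carrier 0ℓ → Pred Carrier 0ℓ → Set
  P ≐ Q = ∀ a → (a ∈ P) ⇔ (a ∈ Q)

  _⪯F_ : Filter → Filter → Set
  F ⪯F G = ∀ {g f} → g ∈ set G → f ∈ set F → (g ▷ f) ∈ set F

  _≈F_ : Filter → Filter → Set
  F ≈F G = (F ⪯F G) × (G ⪯F F)

-- The relation a ⪯ b (a ≤ b ▷ a) is a preorder containing ≤ in which a ▷ b is a
-- greatest lower bound.  Hence π[F]↑ is a filter, as f · g ∈ F lies ⪯-below f and g.
-- A filter Q of A/∼ is π[F]↑ for F the ≤-upward closure of {q ▷ e | q ∈ Q}, with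
-- e ∈ Q fixed: q ▷ e ⪯ q, and q ▷ e ∈ Q.  For the order: if G ▷ F ⊆ F then
-- g ▷ f₀ ∈ F lies ⪯-below g; conversely if f′ ⪯ g for some f′ ∈ F, then f · f′ ≤ g ▷ f
-- for every f ∈ F, so g ▷ f ∈ F.
module Submission where

open import Defs
open import Data.Product using (∃; _×_; _,_; proj₁; proj₂)
open import Relation.Unary using (_∈_; _⊆_)
open import Function.Bundles using (_⇔_; mk⇔; Equivalence)
open import Relation.Binary.PropositionalEquality
  using (_≡_; sym; trans; cong; cong₂; subst; module ≡-Reasoning)

module MinusTriAlgebraProperties (A : MinusTriAlgebra) where
  open MinusTriAlgebra A
  open AlgebraNotions A
  open ≡-Reasoning

  x-y-y≡x-y : ∀ x y → x - y - y ≡ x - y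
  x-y-y≡x-y x y = trans (cong (x - y -_) (sym (ax1 y x))) (ax1 (x - y) y)

  x-x≡y-x-[y-x] : ∀ x y → x - x ≡ y - x - (y - x)
  x-x≡y-x-[y-x] x y = begin
      x - x                      ≡⟨ cong₂ _-_ (sym (ax1 x y)) (sym (ax1 x y)) ⟩
      x - p - (x - p)            ≡⟨ ax3 x p (x - p) ⟩
      x - (x - p) - p            ≡⟨ cong (_- p) (ax2 x p) ⟩
      p - (p - x) - p            ≡⟨ cong (λ t → p - t - p) (x-y-y≡x-y y x) ⟩
      p - p - p                  ≡⟨ x-y-y≡x-y p p ⟩
      p - p                      ∎
    where p = y - x

  x-x≡y-y : ∀ x y → x - x ≡ y - y
  x-x≡y-y x y = begin
      x - x                      ≡⟨ x-x≡y-x-[y-x] x (x - y) ⟩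
      x - y - x - (x - y - x)    ≡⟨ cong₂ _-_ (ax3 x y x) (ax3 x y x) ⟩
      x - x - y - (x - x - y)    ≡⟨ sym (x-x≡y-x-[y-x] y (x - x)) ⟩
      y - y                      ∎

  x-x-y≡x-x : ∀ x y → x - x - y ≡ x - x
  x-x-y≡x-x x y = trans (cong (_- y) (x-x≡y-y x y)) (trans (x-y-y≡x-y y y) (x-x≡y-y y x))

  x-[y-y]≡x : ∀ x y → x - (y - y) ≡ x
  x-[y-y]≡x x y = trans (cong (x -_) (x-x≡y-y y x)) (ax1 x x)

  x-x·y≡x-y : ∀ x y → x - x · y ≡ x - y
  x-x·y≡x-y x y = begin
      x - (x - (x - y))          ≡⟨ ax2 x (x - y) ⟩
      x - y - (x - y - x)        ≡⟨ cong (x - y -_) (trans (ax3 x y x) (x-x-y≡x-x x y)) ⟩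
      x - y - (x - x)            ≡⟨ x-[y-y]≡x (x - y) x ⟩
      x - y                      ∎

  ≤⇒x-y≡x-x : ∀ {x y} → x ≤ y → x - y ≡ x - x
  ≤⇒x-y≡x-x {x} {y} x≤y = begin
      x - y                      ≡⟨ cong (_- y) (sym x≤y) ⟩
      x - (x - y) - y            ≡⟨ ax3 x (x - y) y ⟩
      x - y - (x - y)            ≡⟨ x-x≡y-y (x - y) x ⟩
      x - x                      ∎

  x-y≡x-x⇒≤ : ∀ {x y} → x - y ≡ x - x → x ≤ y
  x-y≡x-x⇒≤ {x} e = trans (cong (x -_) e) (ax1 x x)

  ≤-refl : ∀ x → x ≤ x
  ≤-refl x = ax1 x x

  ≤-trans : ∀ {x y z} → x ≤ y → y ≤ z → x ≤ z
  ≤-trans {x} {y} {z} x≤y y≤z = x-y≡x-x⇒≤ (begin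
      x - z                      ≡⟨ cong (_- z) (sym (trans (ax2 y x) x≤y)) ⟩
      y - (y - x) - z            ≡⟨ ax3 y (y - x) z ⟩
      y - z - (y - x)            ≡⟨ cong (_- (y - x)) (≤⇒x-y≡x-x y≤z) ⟩
      y - y - (y - x)            ≡⟨ x-x-y≡x-x y (y - x) ⟩
      y - y                      ≡⟨ x-x≡y-y y x ⟩
      x - x                      ∎)

  x·y≤x : ∀ x y → (x · y) ≤ x
  x·y≤x x y = x-y≡x-x⇒≤ (begin
      x - (x - y) - x            ≡⟨ ax3 x (x - y) x ⟩
      x - x - (x - y)            ≡⟨ x-x-y≡x-x x (x - y) ⟩
      x - x                      ≡⟨ x-x≡y-y x (x · y) ⟩
      x · y - x · y              ∎)

  x·y≤y : ∀ x y → (x · y) ≤ y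
  x·y≤y x y = subst (_≤ y) (ax2 y x) (x·y≤x y x)

  ·-greatest : ∀ {z x y} → z ≤ x → z ≤ y → z ≤ (x · y)
  ·-greatest {z} {x} {y} z≤x z≤y = x-y≡x-x⇒≤ (begin
      z - x · y                  ≡⟨ cong (_- x · y) (sym (trans (ax2 x z) z≤x)) ⟩
      x - (x - z) - x · y        ≡⟨ ax3 x (x - z) (x · y) ⟩
      x - x · y - (x - z)        ≡⟨ cong (_- (x - z)) (x-x·y≡x-y x y) ⟩
      x - y - (x - z)            ≡⟨ ax3 x y (x - z) ⟩
      x - (x - z) - y            ≡⟨ cong (_- y) (ax2 x z) ⟩
      z - (z - x) - y            ≡⟨ ax3 z (z - x) y ⟩
      z - y - (z - x)            ≡⟨ cong (_- (z - x)) (≤⇒x-y≡x-x z≤y) ⟩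
      z - z - (z - x)            ≡⟨ x-x-y≡x-x z (z - x) ⟩
      z - z                      ∎)

  ≤⇒x▷y≡x : ∀ {x y} → x ≤ y → x ▷ y ≡ x
  ≤⇒x▷y≡x {x} {y} x≤y = trans (cong (_▷ y) (sym y·x≡x)) (trans (ax5 y x) y·x≡x)
    where y·x≡x = trans (ax2 y x) x≤y

  ▷-monoˡ-≤ : ∀ {x y} z → x ≤ y → (x ▷ z) ≤ (y ▷ z)
  ▷-monoˡ-≤ {x} {y} z x≤y = trans (ax4 x y z) (cong (_▷ z) (≤⇒x▷y≡x x≤y))

  ▷-idem : ∀ x → x ▷ x ≡ x
  ▷-idem x = ≤⇒x▷y≡x (≤-refl x)

  [x▷y]▷z≤x▷z : ∀ x y z → ((x ▷ y) ▷ z) ≤ (x ▷ z)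
  [x▷y]▷z≤x▷z x y z = subst (_≤ (x ▷ z)) (ax4 x y z) (x·y≤x (x ▷ z) (y ▷ z))

  ≤⇒⪯ : ∀ {x y} → x ≤ y → x ⪯ y
  ≤⇒⪯ {x} {y} x≤y = subst (_≤ (y ▷ x)) (▷-idem x) (▷-monoˡ-≤ x x≤y)

  ⪯-refl : ∀ x → x ⪯ x
  ⪯-refl x = ≤⇒⪯ (≤-refl x)

  ⪯-trans : ∀ {x y z} → x ⪯ y → y ⪯ z → x ⪯ z
  ⪯-trans {x} {y} {z} x⪯y y⪯z =
    ≤-trans x⪯y (≤-trans (▷-monoˡ-≤ x y⪯z) ([x▷y]▷z≤x▷z z y x))

  x▷y⪯x : ∀ x y → (x ▷ y) ⪯ x
  x▷y⪯x x y = subst (_≤ (x ▷ (x ▷ y)))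
    (trans (ax4 x y (x ▷ y)) (▷-idem (x ▷ y)))
    (x·y≤x (x ▷ (x ▷ y)) (y ▷ (x ▷ y)))

  ▷-greatest : ∀ {z x y} → z ⪯ x → z ⪯ y → z ⪯ (x ▷ y)
  ▷-greatest {z} {x} {y} z⪯x z⪯y = subst (z ≤_) (ax4 x y z) (·-greatest z⪯x z⪯y)

  ≤∧⪯⇒≤▷ : ∀ {z x y} → z ≤ x → z ⪯ y → z ≤ (y ▷ x)
  ≤∧⪯⇒≤▷ {z} {x} {y} z≤x z⪯y =
    ≤-trans (subst (_≤ ((y ▷ z) ▷ x)) (≤⇒x▷y≡x z≤x) (▷-monoˡ-≤ x z⪯y))
            ([x▷y]▷z≤x▷z y z x)

  ≤⇒⪯-trans : ∀ {x y z} → x ≤ y → y ⪯ z → x ⪯ z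
  ≤⇒⪯-trans x≤y = ⪯-trans (≤⇒⪯ x≤y)

  πUp-isQFilter : (F : Filter) → IsQFilter (πUp (set F))
  πUp-isQFilter F = respects , nonempty′ , upward′ , meet′
    where
    respects : ∀ {a b} → a ∼ b → a ∈ πUp (set F) → b ∈ πUp (set F)
    respects (a⪯b , _) (f , f∈F , f⪯a) = f , f∈F , ⪯-trans f⪯a a⪯b

    nonempty′ : ∃ (πUp (set F))
    nonempty′ = let (f , f∈F) = nonempty F in f , f , f∈F , ⪯-refl f

    upward′ : ∀ {a b} → a ∈ πUp (set F) → a ⪯ b → b ∈ πUp (set F)
    upward′ (f , f∈F , f⪯a) a⪯b = f , f∈F , ⪯-trans f⪯a a⪯b

    meet′ : ∀ {a b} → a ∈ πUp (set F) → b ∈ πUp (set F) → (a ▷ b) ∈ πUp (set F)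
    meet′ (f , f∈F , f⪯a) (g , g∈F , g⪯b) =
      f · g , meet F f∈F g∈F ,
      ▷-greatest (≤⇒⪯-trans (x·y≤x f g) f⪯a) (≤⇒⪯-trans (x·y≤y f g) g⪯b)

  module _ (Q : QFilter) where
    private
      e = proj₁ (qnonempty Q)
      e∈Q = proj₂ (qnonempty Q)

    liftQFilter : Filter
    set liftQFilter x = ∃ λ q → q ∈ qset Q × (q ▷ e) ≤ x
    nonempty liftQFilter = e , e , e∈Q , subst (_≤ e) (sym (▷-idem e)) (≤-refl e)
    upward liftQFilter (q , q∈Q , q▷e≤x) x≤y = q , q∈Q , ≤-trans q▷e≤x x≤y
    meet liftQFilter {x} {y} (q , q∈Q , q▷e≤x) (r , r∈Q , r▷e≤y) =
      q ▷ r , qmeet Q q∈Q r∈Q ,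
      subst (_≤ (x · y)) (ax4 q r e)
        (·-greatest (≤-trans (x·y≤x _ _) q▷e≤x) (≤-trans (x·y≤y _ _) r▷e≤y))

    qset≐πUp-liftQFilter : qset Q ≐ πUp (set liftQFilter)
    qset≐πUp-liftQFilter a = mk⇔
      (λ a∈Q → a ▷ e , (a , a∈Q , ≤-refl _) , x▷y⪯x a e)
      (λ { (f , (q , q∈Q , q▷e≤f) , f⪯a) →
           qupward Q (qmeet Q q∈Q e∈Q) (≤⇒⪯-trans q▷e≤f f⪯a) })

  ⪯F⇒πUp-⊇ : ∀ F G → F ⪯F G → πUp (set G) ⊆ πUp (set F)
  ⪯F⇒πUp-⊇ F G G▷F⊆F (g , g∈G , g⪯a) =
    let (f , f∈F) = nonempty F in
    g ▷ f , G▷F⊆F g∈G f∈F , ⪯-trans (x▷y⪯x g f) g⪯a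

  πUp-⊇⇒⪯F : ∀ F G → πUp (set G) ⊆ πUp (set F) → F ⪯F G
  πUp-⊇⇒⪯F F G G⊆F {g} {f} g∈G f∈F with G⊆F (g , g∈G , ⪯-refl g)
  ... | (f′ , f′∈F , f′⪯g) =
    upward F (meet F f∈F f′∈F) (≤∧⪯⇒≤▷ (x·y≤x f f′) (≤⇒⪯-trans (x·y≤y f f′) f′⪯g))

  ⪯F⇔πUp-⊇ : ∀ F G → F ⪯F G ⇔ πUp (set G) ⊆ πUp (set F)
  ⪯F⇔πUp-⊇ F G = mk⇔ (⪯F⇒πUp-⊇ F G) (πUp-⊇⇒⪯F F G)

  ≈F⇔πUp-≐ : ∀ F G → F ≈F G ⇔ πUp (set F) ≐ πUp (set G)
  ≈F⇔πUp-≐ F G = mk⇔ to from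
    where
    to : F ≈F G → πUp (set F) ≐ πUp (set G)
    to (F⪯G , G⪯F) _ = mk⇔ (⪯F⇒πUp-⊇ G F G⪯F) (⪯F⇒πUp-⊇ F G F⪯G)

    from : πUp (set F) ≐ πUp (set G) → F ≈F G
    from F≐G = πUp-⊇⇒⪯F F G (Equivalence.from (F≐G _))
             , πUp-⊇⇒⪯F G F (Equivalence.to (F≐G _))

proposition4p4 : (A : MinusTriAlgebra) → let open AlgebraNotions A in
    ((F : Filter) → IsQFilter (πUp (set F)))
    × ((Q : QFilter) → ∃ λ (F : Filter) → qset Q ≐ πUp (set F))
    × ((F G : Filter) → (F ⪯F G) ⇔ (πUp (set G) ⊆ πUp (set F)))
    × ((F G : Filter) → (F ≈F G) ⇔ (πUp (set F) ≐ πUp (set G)))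
proposition4p4 A =
    πUp-isQFilter
  , (λ Q → liftQFilter Q , qset≐πUp-liftQFilter Q)
  , ⪯F⇔πUp-⊇
  , ≈F⇔πUp-≐
  where open MinusTriAlgebraProperties A
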